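{- There is a constant $C>0$ such that for all integers $k\ge 2$ and all positive integers $n,m$, $$nm-2\sqrt{2}\sqrt{nm}-C(\sqrt{n}+\sqrt{m})\ \le\ \mathrm{HB2}_k(n,m).$$
   Context: A two-dimensional partial word of size $n$ by $m$ over an alphabet $A$ is a map $w:\{0,\dots,n-1\}\times\{0,\dots,m-1\}\to A\cup\{\diamondsuit\}$, where $\diamondsuit\notin A$ is a hole; its domain $\mathrm{D}(w)$ is the set of positions $p$ with $w(p)\in A$. An $(n,m)$-ruler is a subset $R\subseteq\{0,\dots,n-1\}\times\{0,\dots,m-1\}$ such that every $(x,y)\in\mathbb{Z}^2$ with $|x|\le n-1$, $|y|\le m-1$ equals $r_1-r_2$ for some $r_1,r_2\in R$. The two-dimensional partial word $w$ is unbordered if $\mathrm{D}(w)$ is an $(n,m)$-ruler and for every nonzero vector $v$ with $|v_1|\le n-1$, $|v_2|\le m-1$ there exist $r_1,r_2\in\mathrm{D}(w)$ with $r_1-r_2=v$ and $w(r_1)\ne w(r_2)$. $\mathrm{HB2}_k(n,m)$ denotes the maximum number of holes an $n$ by $m$ unbordered two-dimensional partial word over an alphabet of size $k$ can have. -}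

module Defs where

open import Data.Nat using (ℕ; zero; suc; _∸_; _≤_)
open import Data.Fin using (Fin; toℕ)
open import Data.Maybe using (Maybe; just; nothing)
open import Data.List using (List; map; allFin)
open import Data.Nat.ListAction using (sum)
open import Data.Integer as ℤ using (ℤ; +_; ∣_∣; _-_)
open import Data.Product using (Σ; ∃; _×_; _,_)
open import Relation.Binary.PropositionalEquality using (_≡_; _≢_)
open import Relation.Nullary using (¬_)

-- A 2D partial word of size n by m over the alphabet Fin k:
-- nothing is the hole ◇, just a is the letter a.
PWord2 : ℕ → ℕ → ℕ → Set
PWord2 k n m = Fin n → Fin m → Maybe (Fin k)

InDom : ∀ {k n m} → PWord2 k n m → Fin n → Fin m → Set
InDom w i j = ∃ λ a → w i j ≡ just a

Admissible : ℕ → ℕ → ℤ → ℤ → Set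
Admissible n m x y = (∣ x ∣ ≤ n ∸ 1) × (∣ y ∣ ≤ m ∸ 1)

DiffIs : ∀ {n m} → Fin n → Fin m → Fin n → Fin m → ℤ → ℤ → Set
DiffIs i1 j1 i2 j2 x y =
  ((+ toℕ i1) - (+ toℕ i2) ≡ x) × ((+ toℕ j1) - (+ toℕ j2) ≡ y)

IsRuler : (n m : ℕ) → (Fin n → Fin m → Set) → Set
IsRuler n m R = ∀ (x y : ℤ) → Admissible n m x y →
  Σ (Fin n) λ i1 → Σ (Fin m) λ j1 → Σ (Fin n) λ i2 → Σ (Fin m) λ j2 →
    R i1 j1 × R i2 j2 × DiffIs i1 j1 i2 j2 x y

Unbordered : ∀ {k n m} → PWord2 k n m → Set
Unbordered {k} {n} {m} w =
  IsRuler n m (InDom w) ×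
  (∀ (x y : ℤ) → Admissible n m x y → ¬ (x ≡ + 0 × y ≡ + 0) →
    Σ (Fin n) λ i1 → Σ (Fin m) λ j1 → Σ (Fin n) λ i2 → Σ (Fin m) λ j2 →
    Σ (Fin k) λ a → Σ (Fin k) λ b →
      (w i1 j1 ≡ just a) × (w i2 j2 ≡ just b) × (a ≢ b) × DiffIs i1 j1 i2 j2 x y)

isHole : ∀ {k} → Maybe (Fin k) → ℕ
isHole nothing  = 1
isHole (just _) = 0

holes : ∀ {k n m} → PWord2 k n m → ℕ
holes {k} {n} {m} w = sum (map (λ i → sum (map (λ j → isHole (w i j)) (allFin m))) (allFin n))

IsHB2 : ℕ → ℕ → ℕ → ℕ → Set
IsHB2 k n m h =
  (Σ (PWord2 k n m) λ w → Unbordered w × holes w ≡ h) ×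
  (∀ (w : PWord2 k n m) → Unbordered w → holes w ≤ h)

{-# OPTIONS --safe #-}
-- For n ≥ 8 let s = ⌊√(n/2)⌋ and t = ⌊√m⌋, and take the word over {0, 1} with 1 in the first and the
-- last t columns of rows 0 … s−1 and in the first t columns of row s+1, with 0 wherever a grid row
-- (a multiple of s, row s+1 or the last row) meets a grid column (a multiple of t or the last column),
-- and holes elsewhere.  Every s consecutive rows contain a grid row other than s+1 and every t
-- consecutive columns contain a grid column, so each shift (x, y) with x > 0 carries a 0 onto one
-- of the two blocks of 1s, while a shift along a row carries a 0 of row s+1 onto its 1s: the word is
-- unbordered.  Its domain has at most 2st + t + (2s+7)(t+3) = 4st + O(s + t) positions, and
-- 4st ≤ √(8nm).  If n < 8 ≤ m transpose; if n, m < 8 the bound is trivial for C = 49.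
module Submission where

open import Defs

open import Data.Bool.Base using (Bool; true; false; _∧_; _∨_)
open import Data.Fin.Base using (Fin; toℕ; fromℕ<)
open import Data.Fin.Patterns using (0F; 1F)
open import Data.Fin.Properties using (toℕ<n; toℕ-fromℕ<)
open import Data.Integer.Base as ℤ using (ℤ; +_; -[1+_]; -_; _-_; _⊖_)
import Data.Integer.Properties as ℤₚ
open import Data.Integer.Tactic.RingSolver using () renaming (solve-∀ to ℤ-solve-∀)
open import Data.List.Base using (_∷_; map; applyUpTo; tabulate; allFin; _∷ʳ_)
open import Data.List.Properties using (applyUpTo-∷ʳ; map-tabulate; map-cong)
open import Data.Maybe.Base using (Maybe; just; nothing)
open import Data.Nat.Base hiding (_/_)
open import Data.Nat.Coprimality using (1-coprimeTo) renaming (sym to coprime-sym)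
open import Data.Nat.DivMod using (_divMod_; result)
open import Data.Nat.Divisibility using (_∣_; _∣?_; divides; divides-refl; ∣-refl; ∣⇒≤; ∣1⇒≡1; ∣m+n∣m⇒∣n)
open import Data.Nat.ListAction using (sum)
open import Data.Nat.ListAction.Properties using (sum-++)
open import Data.Nat.Properties
open import Algebra.Properties.CommutativeSemigroup +-commutativeSemigroup using (interchange)
open import Data.Nat.Tactic.RingSolver using (solve-∀)
open import Data.Product using (Σ; ∃; ∃₂; ∃-syntax; _×_; _,_; proj₁; proj₂)
open import Data.Rational.Base as ℚ using (ℚ; toℚᵘ; _/_; 0ℚ)
import Data.Rational.Properties as ℚₚ
open import Data.Rational.Unnormalised.Base as ℚᵘ using (mkℚᵘ; *≡*)
import Data.Rational.Unnormalised.Properties as ℚᵘₚ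
open import Data.Sum using (_⊎_; inj₁; inj₂)
open import Function using (_∘_; _$_; flip)
open import Level using (0ℓ)
open import Relation.Binary.PropositionalEquality
  using (_≡_; _≢_; refl; sym; trans; cong; cong₂; subst; subst₂; module ≡-Reasoning)
open import Relation.Nullary using (¬_; yes; no; does; contradiction; _×-dec_)
open import Relation.Nullary.Decidable using (dec-true; dec-false)
open import Relation.Unary using (Pred; Decidable)
open import Relation.Unary.Properties using (_∪?_)

-- Sums and counts over initial segments of ℕ

∑< : ℕ → (ℕ → ℕ) → ℕ
∑< n f = sum (applyUpTo f n)

syntax ∑< n (λ i → e) = ∑[ i < n ] e

∑-suc : ∀ n f → ∑< (suc n) f ≡ ∑< n f + f n
∑-suc n f = begin
  sum (applyUpTo f (suc n))   ≡⟨ cong sum (applyUpTo-∷ʳ f n) ⟨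
  sum (applyUpTo f n ∷ʳ f n)  ≡⟨ sum-++ (applyUpTo f n) _ ⟩
  ∑< n f + (f n + 0)          ≡⟨ cong (_+_ (∑< n f)) (+-identityʳ (f n)) ⟩
  ∑< n f + f n                ∎
  where open ≡-Reasoning

∑-cong : ∀ n {f g} → (∀ i → f i ≡ g i) → ∑< n f ≡ ∑< n g
∑-cong zero    f≡g = refl
∑-cong (suc n) f≡g = cong₂ _+_ (f≡g 0) (∑-cong n (f≡g ∘ suc))

∑-mono : ∀ n {f g} → (∀ i → f i ≤ g i) → ∑< n f ≤ ∑< n g
∑-mono zero    f≤g = z≤n
∑-mono (suc n) f≤g = +-mono-≤ (f≤g 0) (∑-mono n (f≤g ∘ suc))

∑-const : ∀ n c → ∑[ _ < n ] c ≡ n * c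
∑-const zero    c = refl
∑-const (suc n) c = cong (_+_ c) (∑-const n c)

∑-+ : ∀ n f g → ∑[ i < n ] (f i + g i) ≡ ∑< n f + ∑< n g
∑-+ zero    f g = refl
∑-+ (suc n) f g = trans (cong (_+_ (f 0 + g 0)) (∑-+ n (f ∘ suc) (g ∘ suc)))
                        (interchange (f 0) (g 0) (∑< n (f ∘ suc)) (∑< n (g ∘ suc)))

∑-*ˡ : ∀ n c f → ∑[ i < n ] (c * f i) ≡ c * ∑< n f
∑-*ˡ zero    c f = sym (*-zeroʳ c)
∑-*ˡ (suc n) c f = trans (cong (_+_ (c * f 0)) (∑-*ˡ n c (f ∘ suc))) (sym (*-distribˡ-+ c (f 0) _))

∑-*ʳ : ∀ n c f → ∑[ i < n ] (f i * c) ≡ ∑< n f * c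
∑-*ʳ zero    c f = refl
∑-*ʳ (suc n) c f = trans (cong (_+_ (f 0 * c)) (∑-*ʳ n c (f ∘ suc))) (sym (*-distribʳ-+ c (f 0) _))

∑-product : ∀ n m f g → ∑[ i < n ] ∑[ j < m ] (f i * g j) ≡ ∑< n f * ∑< m g
∑-product n m f g = trans (∑-cong n (λ i → ∑-*ˡ m (f i) g)) (∑-*ʳ n (∑< m g) f)

∑∑-+ : ∀ n m (f g : ℕ → ℕ → ℕ) →
  ∑[ i < n ] ∑[ j < m ] (f i j + g i j) ≡ ∑[ i < n ] ∑[ j < m ] f i j + ∑[ i < n ] ∑[ j < m ] g i j
∑∑-+ n m f g = trans (∑-cong n (λ i → ∑-+ m (f i) (g i))) (∑-+ n _ _)

∑-comm : ∀ n m (f : ℕ → ℕ → ℕ) → ∑[ i < n ] ∑[ j < m ] f i j ≡ ∑[ j < m ] ∑[ i < n ] f i j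
∑-comm zero    m f = sym (trans (∑-const m 0) (*-zeroʳ m))
∑-comm (suc n) m f = trans (cong (_+_ (∑< m (f 0))) (∑-comm n m (f ∘ suc)))
                           (sym (∑-+ m (f 0) (λ j → ∑[ i < n ] f (suc i) j)))

𝟙 : Bool → ℕ
𝟙 true  = 1
𝟙 false = 0

𝟙≤1 : ∀ b → 𝟙 b ≤ 1
𝟙≤1 true  = ≤-refl
𝟙≤1 false = z≤n

𝟙-∨ : ∀ a b → 𝟙 (a ∨ b) ≤ 𝟙 a + 𝟙 b
𝟙-∨ true  b = s≤s z≤n
𝟙-∨ false b = ≤-refl

𝟙-∧ : ∀ a b → 𝟙 (a ∧ b) ≡ 𝟙 a * 𝟙 b
𝟙-∧ true  b = sym (+-identityʳ (𝟙 b))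
𝟙-∧ false b = refl

module _ {P : Pred ℕ 0ℓ} (P? : Decidable P) where

  count : ℕ → ℕ
  count n = ∑[ i < n ] 𝟙 (does (P? i))

  count-yes : ∀ n → P n → count (suc n) ≡ suc (count n)
  count-yes n p = trans (∑-suc n _) (trans (cong (λ b → count n + 𝟙 b) (dec-true (P? n) p)) (+-comm (count n) 1))

  count-no : ∀ n → ¬ P n → count (suc n) ≡ count n
  count-no n ¬p = trans (∑-suc n _) (trans (cong (λ b → count n + 𝟙 b) (dec-false (P? n) ¬p)) (+-identityʳ (count n)))

  count≤n : ∀ n → count n ≤ n
  count≤n n = ≤-trans (∑-mono n (λ i → 𝟙≤1 _)) (≤-reflexive (trans (∑-const n 1) (*-identityʳ n)))

  count-none : ∀ n → (∀ i → i < n → ¬ P i) → count n ≡ 0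
  count-none zero    _  = refl
  count-none (suc n) ¬P = trans (count-no n (¬P n ≤-refl)) (count-none n (λ i i<n → ¬P i (m<n⇒m<1+n i<n)))

  count-unique : (∀ {i j} → P i → P j → i ≡ j) → ∀ n → count n ≤ 1
  count-unique unique zero    = z≤n
  count-unique unique (suc n) with P? n
  ... | yes p = ≤-reflexive (trans (count-yes n p) (cong suc (count-none n (λ i i<n q → <⇒≢ i<n (unique q p)))))
  ... | no ¬p = ≤-trans (≤-reflexive (count-no n ¬p)) (count-unique unique n)

count-∪ : ∀ {P Q : Pred ℕ 0ℓ} (P? : Decidable P) (Q? : Decidable Q) n → count (P? ∪? Q?) n ≤ count P? n + count Q? n
count-∪ P? Q? n = ≤-trans (∑-mono n (λ i → 𝟙-∨ (does (P? i)) (does (Q? i)))) (≤-reflexive (∑-+ n _ _))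

count-< : ∀ t n → count (_<? t) n ≤ t
count-< t zero = z≤n
count-< t (suc n) with n <? t
... | yes n<t = ≤-trans (≤-reflexive (count-yes (_<? t) n n<t)) (≤-trans (s≤s (count≤n (_<? t) n)) n<t)
... | no  n≮t = ≤-trans (≤-reflexive (count-no (_<? t) n n≮t)) (count-< t n)

count-last : ∀ t n → count (λ j → n ≤? j + t) n ≤ t
count-last t n = subst (count (λ j → n ≤? j + t) n ≤_) (m+n∸m≡n n t) (count≤ n)
  where
  count≤ : ∀ r → count (λ j → n ≤? j + t) r ≤ r + t ∸ n
  count≤ zero = z≤n
  count≤ (suc r) with n ≤? r + t
  ... | yes n≤r+t = begin
    count (λ j → n ≤? j + t) (suc r) ≡⟨ count-yes (λ j → n ≤? j + t) r n≤r+t ⟩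
    suc (count (λ j → n ≤? j + t) r) ≤⟨ s≤s (count≤ r) ⟩
    suc (r + t ∸ n)                  ≡⟨ +-∸-assoc 1 n≤r+t ⟨
    suc r + t ∸ n                    ∎
    where open ≤-Reasoning
  ... | no  n≰r+t = begin
    count (λ j → n ≤? j + t) (suc r) ≡⟨ count-no (λ j → n ≤? j + t) r n≰r+t ⟩
    count (λ j → n ≤? j + t) r       ≤⟨ count≤ r ⟩
    r + t ∸ n                        ≤⟨ ∸-monoˡ-≤ n (n≤1+n (r + t)) ⟩
    suc r + t ∸ n                    ∎
    where open ≤-Reasoning

count-∣ : ∀ u .{{_ : NonZero u}} n → u * count (u ∣?_) n < n + u
count-∣ u n = proj₂ (brackets n)
  where
  brackets : ∀ n → n ≤ u * count (u ∣?_) n × u * count (u ∣?_) n < n + u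
  brackets zero = z≤n , subst (_< u) (sym (*-zeroʳ u)) (>-nonZero⁻¹ u)
  brackets (suc n) with u ∣? n | brackets n
  ... | yes u∣n@(divides-refl q) | qu≤uc , uc<qu+u = lo , hi
    where
    u*[1+q]≡qu+u : u * suc q ≡ q * u + u
    u*[1+q]≡qu+u = trans (*-suc u q) (trans (+-comm u (u * q)) (cong (_+ u) (*-comm u q)))
    c≡q : count (u ∣?_) (q * u) ≡ q
    c≡q = ≤-antisym (≤-pred (*-cancelˡ-< u c (suc q) (subst (u * c <_) (sym u*[1+q]≡qu+u) uc<qu+u)))
                    (*-cancelˡ-≤ u (subst (_≤ u * c) (*-comm q u) qu≤uc))
      where c = count (u ∣?_) (q * u)
    uc′≡qu+u : u * count (u ∣?_) (suc (q * u)) ≡ q * u + u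
    uc′≡qu+u = trans (cong (u *_) (trans (count-yes (u ∣?_) (q * u) u∣n) (cong suc c≡q))) u*[1+q]≡qu+u
    lo : suc (q * u) ≤ u * count (u ∣?_) (suc (q * u))
    lo = subst (suc (q * u) ≤_) (sym uc′≡qu+u) (m<m+n (q * u) (>-nonZero⁻¹ u))
    hi : u * count (u ∣?_) (suc (q * u)) < suc (q * u) + u
    hi = subst (_< suc (q * u) + u) (sym uc′≡qu+u) (n<1+n (q * u + u))
  ... | no u∤n | n≤uc , uc<n+u = lo , hi
    where
    uc′≡uc : u * count (u ∣?_) (suc n) ≡ u * count (u ∣?_) n
    uc′≡uc = cong (u *_) (count-no (u ∣?_) n u∤n)
    lo : suc n ≤ u * count (u ∣?_) (suc n)
    lo = subst (suc n ≤_) (sym uc′≡uc) (≤∧≢⇒< n≤uc (λ n≡uc → u∤n (divides (count (u ∣?_) n) (trans n≡uc (*-comm u _)))))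
    hi : u * count (u ∣?_) (suc n) < suc n + u
    hi = subst (_< suc n + u) (sym uc′≡uc) (m<n⇒m<1+n uc<n+u)

-- Multiples in windows and integer square roots

floor-multiple : ∀ u .{{_ : NonZero u}} z → ∃[ q ] q * u ≤ z × z < q * u + u
floor-multiple u z with z divMod u
... | result q r refl = q , m≤n+m (q * u) (toℕ r) , subst (_< q * u + u) (+-comm (q * u) (toℕ r)) (+-monoʳ-< (q * u) (toℕ<n r))

ceil-multiple : ∀ u .{{_ : NonZero u}} y → ∃[ q ] y ≤ q * u × q * u < y + u
ceil-multiple (suc u) y with floor-multiple (suc u) (y + u)
... | q , qv≤y+u , y+u<qv+v =
  q , +-cancelʳ-≤ u y (q * suc u) (≤-pred (subst (y + u <_) (+-suc (q * suc u) u) y+u<qv+v)) ,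
  ≤-<-trans qv≤y+u (+-monoʳ-< y (n<1+n u))

window-offset : ∀ {u y ℓ} → y ≤ ℓ → ℓ < y + u → ∃[ d ] d < u × d + y ≡ ℓ
window-offset {u} {y} {ℓ} y≤ℓ ℓ<y+u =
  ℓ ∸ y , +-cancelʳ-< y (ℓ ∸ y) u (subst₂ _<_ (sym (m∸n+n≡m y≤ℓ)) (+-comm y u) ℓ<y+u) , m∸n+n≡m y≤ℓ

gridline-in-window : ∀ u .{{_ : NonZero u}} {m} y → y < m →
  ∃[ d ] d < u × d + y < m × (u ∣ d + y ⊎ suc (d + y) ≡ m)
gridline-in-window u {suc m} y y<m with ceil-multiple u y
... | q , y≤qu , qu<y+u with q * u <? suc m
...   | yes qu<m =
  let d , d<u , d+y≡qu = window-offset y≤qu qu<y+u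
  in  d , d<u , subst (_< suc m) (sym d+y≡qu) qu<m , inj₁ (divides q d+y≡qu)
...   | no  qu≮m =
  let d , d<u , d+y≡m = window-offset (≤-pred y<m) (<-≤-trans (≮⇒≥ qu≮m) (<⇒≤ qu<y+u))
  in  d , d<u , s≤s (≤-reflexive d+y≡m) , inj₂ (cong suc d+y≡m)

multiple-before-end : ∀ u .{{_ : NonZero u}} {m} y → y < m → ∃[ q ] q * u + y < m × m ≤ q * u + y + u
multiple-before-end u y y<m with m≤n⇒∃[o]m+o≡n y<m
... | z , refl with floor-multiple u z
...   | q , qu≤z , z<qu+u = q , s≤s (subst (q * u + y ≤_) (+-comm z y) (+-monoˡ-≤ y qu≤z)) , (begin
  suc y + z      ≡⟨ cong suc (+-comm y z) ⟩
  suc z + y      ≤⟨ +-monoˡ-≤ y z<qu+u ⟩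
  q * u + u + y  ≡⟨ +-assoc (q * u) u y ⟩
  q * u + (u + y) ≡⟨ cong (_+_ (q * u)) (+-comm u y) ⟩
  q * u + (y + u) ≡⟨ +-assoc (q * u) y u ⟨
  q * u + y + u  ∎)
  where open ≤-Reasoning

scaled-sqrt : ∀ k .{{_ : NonZero k}} n → ∃[ r ] k * (r * r) ≤ n × n < k * (suc r * suc r)
scaled-sqrt k zero = 0 , ≤-reflexive (*-zeroʳ k) , subst (0 <_) (sym (*-identityʳ k)) (>-nonZero⁻¹ k)
scaled-sqrt k (suc n) with scaled-sqrt k n
... | r , kr²≤n , n<k[1+r]² with k * (suc r * suc r) ≤? suc n
...   | yes k[1+r]²≤1+n = suc r , k[1+r]²≤1+n ,
        ≤-<-trans n<k[1+r]² (*-monoʳ-< k (*-mono-< (n<1+n (suc r)) (n<1+n (suc r))))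
...   | no  k[1+r]²≰1+n = r , m≤n⇒m≤1+n kr²≤n , ≰⇒> k[1+r]²≰1+n

-- Partial words on ℕ × ℕ

+[m+n]-+m≡+n : ∀ m n → + (m + n) - + m ≡ + n
+[m+n]-+m≡+n m n = begin
  + (m + n) - + m   ≡⟨ ℤₚ.[+m]-[+n]≡m⊖n (m + n) m ⟩
  (m + n) ⊖ m       ≡⟨ cong ((m + n) ⊖_) (+-identityʳ m) ⟨
  (m + n) ⊖ (m + 0) ≡⟨ ℤₚ.+-cancelˡ-⊖ m n 0 ⟩
  + n               ∎
  where open ≡-Reasoning

+m-+[m+n]≡-+n : ∀ m n → + m - + (m + n) ≡ - + n
+m-+[m+n]≡-+n m n = begin
  + m - + (m + n)   ≡⟨ ℤₚ.[+m]-[+n]≡m⊖n m (m + n) ⟩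
  m ⊖ (m + n)       ≡⟨ ℤₚ.⊖-swap m (m + n) ⟩
  - ((m + n) ⊖ m)   ≡⟨ cong -_ (trans (sym (ℤₚ.[+m]-[+n]≡m⊖n (m + n) m)) (+[m+n]-+m≡+n m n)) ⟩
  - + n             ∎
  where open ≡-Reasoning

-- Positions are natural numbers so that the construction can compute with them;
-- only the n × m corner cut out by `restrict` matters.
Word : ℕ → Set
Word k = ℕ → ℕ → Maybe (Fin k)

restrict : ∀ {k} n m → Word k → PWord2 k n m
restrict n m w i j = w (toℕ i) (toℕ j)

Mismatch : ∀ {k} → ℕ → ℕ → Word k → (i j i′ j′ : ℕ) → Set
Mismatch {k} n m w i j i′ j′ = i < n × j < m × i′ < n × j′ < m ×
  Σ (Fin k) λ a → Σ (Fin k) λ b → w i j ≡ just a × w i′ j′ ≡ just b × a ≢ b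

mismatch-sym : ∀ {k n m} {w : Word k} {i j i′ j′} → Mismatch n m w i j i′ j′ → Mismatch n m w i′ j′ i j
mismatch-sym (i<n , j<m , i′<n , j′<m , a , b , wij , wi′j′ , a≢b) =
  i′<n , j′<m , i<n , j<m , b , a , wi′j′ , wij , a≢b ∘ sym

mismatch-transpose : ∀ {k n m} {w : Word k} {i j i′ j′} → Mismatch n m w i j i′ j′ → Mismatch m n (flip w) j i j′ i′
mismatch-transpose (i<n , j<m , i′<n , j′<m , mismatch) = j<m , i<n , j′<m , i′<n , mismatch

Separating : ∀ {k} → ℕ → ℕ → Word k → Set
Separating n m w = ∀ x y → Admissible n m x y → ¬ (x ≡ + 0 × y ≡ + 0) →
  ∃₂ λ i j → ∃₂ λ i′ j′ → Mismatch n m w i j i′ j′ × + i - + i′ ≡ x × + j - + j′ ≡ y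

-- Exchanging the two positions negates the shift, so it suffices to separate the shifts (x, y)
-- with x > 0 (either sign of y) and those along a row.
separating-from-quadrants : ∀ {k n m} {w : Word k} .{{_ : NonZero n}} .{{_ : NonZero m}} →
  (∀ x y → 0 < x → x < n → y < m → ∃₂ λ i j → Mismatch n m w (i + x) (j + y) i j) →
  (∀ x y → 0 < x → x < n → 0 < y → y < m → ∃₂ λ i j → Mismatch n m w (i + x) j i (j + y)) →
  (∀ y → 0 < y → y < m → ∃₂ λ i j → Mismatch n m w i (j + y) i j) →
  Separating n m w
separating-from-quadrants {k} {n} {m} {w} descending ascending horizontal = separate
  where
  ≤pred⇒< : ∀ {x l} .{{_ : NonZero l}} → x ≤ pred l → x < l
  ≤pred⇒< = m≤pred[n]⇒suc[m]≤n
  separate : Separating n m w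
  separate (+ zero)  (+ zero)  _         nonzero = contradiction (refl , refl) nonzero
  separate (+ zero)  (+ suc y) (_ , ay)  _ with horizontal (suc y) z<s (≤pred⇒< ay)
  ... | i , j , mm = i , j + suc y , i , j , mm , ℤₚ.+-inverseʳ (+ i) , +[m+n]-+m≡+n j (suc y)
  separate (+ zero)  -[1+ y ]  (_ , ay)  _ with horizontal (suc y) z<s (≤pred⇒< ay)
  ... | i , j , mm = i , j , i , j + suc y , mismatch-sym {w = w} mm , ℤₚ.+-inverseʳ (+ i) , +m-+[m+n]≡-+n j (suc y)
  separate (+ suc x) (+ y)     (ax , ay) _ with descending (suc x) y z<s (≤pred⇒< ax) (≤pred⇒< ay)
  ... | i , j , mm = i + suc x , j + y , i , j , mm , +[m+n]-+m≡+n i (suc x) , +[m+n]-+m≡+n j y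
  separate (+ suc x) -[1+ y ]  (ax , ay) _ with ascending (suc x) (suc y) z<s (≤pred⇒< ax) z<s (≤pred⇒< ay)
  ... | i , j , mm = i + suc x , j , i , j + suc y , mm , +[m+n]-+m≡+n i (suc x) , +m-+[m+n]≡-+n j (suc y)
  separate -[1+ x ]  (+ zero)  (ax , _)  _ with descending (suc x) 0 z<s (≤pred⇒< ax) (>-nonZero⁻¹ m)
  ... | i , j , mm = i , j , i + suc x , j + 0 , mismatch-sym {w = w} mm , +m-+[m+n]≡-+n i (suc x) , +m-+[m+n]≡-+n j 0
  separate -[1+ x ]  (+ suc y) (ax , ay) _ with ascending (suc x) (suc y) z<s (≤pred⇒< ax) z<s (≤pred⇒< ay)
  ... | i , j , mm = i , j + suc y , i + suc x , j , mismatch-sym {w = w} mm , +m-+[m+n]≡-+n i (suc x) , +[m+n]-+m≡+n j (suc y)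
  separate -[1+ x ]  -[1+ y ]  (ax , ay) _ with descending (suc x) (suc y) z<s (≤pred⇒< ax) (≤pred⇒< ay)
  ... | i , j , mm = i , j , i + suc x , j + suc y , mismatch-sym {w = w} mm , +m-+[m+n]≡-+n i (suc x) , +m-+[m+n]≡-+n j (suc y)

separating-transpose : ∀ {k n m} {w : Word k} → Separating n m w → Separating m n (flip w)
separating-transpose separating x y (ax , ay) nonzero
  with separating y x (ay , ax) (λ (y≡0 , x≡0) → nonzero (x≡0 , y≡0))
... | i , j , i′ , j′ , mm , dx , dy = j , i , j′ , i′ , mismatch-transpose mm , dy , dx

SeparatedBy : ∀ {k n m} → PWord2 k n m → ℤ → ℤ → Set
SeparatedBy {k} {n} {m} w x y =
  Σ (Fin n) λ i1 → Σ (Fin m) λ j1 → Σ (Fin n) λ i2 → Σ (Fin m) λ j2 →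
  Σ (Fin k) λ a → Σ (Fin k) λ b →
    (w i1 j1 ≡ just a) × (w i2 j2 ≡ just b) × (a ≢ b) × DiffIs i1 j1 i2 j2 x y

fin-of : ∀ {n i} → i < n → ∃ λ (f : Fin n) → toℕ f ≡ i
fin-of i<n = fromℕ< i<n , toℕ-fromℕ< i<n

mismatch⇒separatedBy : ∀ {k n m} {w : Word k} {i j i′ j′ x y} → Mismatch n m w i j i′ j′ →
  + i - + i′ ≡ x → + j - + j′ ≡ y → SeparatedBy (restrict n m w) x y
mismatch⇒separatedBy (i<n , j<m , i′<n , j′<m , a , b , wij , wi′j′ , a≢b) dx dy
  with fin-of i<n | fin-of j<m | fin-of i′<n | fin-of j′<m
... | f , refl | g , refl | f′ , refl | g′ , refl = f , g , f′ , g′ , a , b , wij , wi′j′ , a≢b , dx , dy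

UnborderedWord : ∀ {k} → ℕ → ℕ → Word k → Set
UnborderedWord n m w = Separating n m w × ∃ λ a → w 0 0 ≡ just a

unbordered-restrict : ∀ {k n m} {w : Word k} → UnborderedWord (suc n) (suc m) w → Unbordered (restrict (suc n) (suc m) w)
unbordered-restrict {k} {n} {m} {w} (separating , a , w00≡a) = ruler , separated
  where
  separated : ∀ x y → Admissible (suc n) (suc m) x y → ¬ (x ≡ + 0 × y ≡ + 0) → SeparatedBy (restrict (suc n) (suc m) w) x y
  separated x y adm nonzero with separating x y adm nonzero
  ... | i , j , i′ , j′ , mm , dx , dy = mismatch⇒separatedBy mm dx dy
  ruler : IsRuler (suc n) (suc m) (InDom (restrict (suc n) (suc m) w))
  ruler x y adm with (x ℤₚ.≟ + 0) ×-dec (y ℤₚ.≟ + 0)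
  ... | yes (refl , refl) = 0F , 0F , 0F , 0F , (a , w00≡a) , (a , w00≡a) , refl , refl
  ... | no nonzero with separated x y adm nonzero
  ...   | i , j , i′ , j′ , a , b , wij , wi′j′ , _ , dxy = i , j , i′ , j′ , (a , wij) , (b , wi′j′) , dxy

holesᴺ : ∀ {k} → ℕ → ℕ → Word k → ℕ
holesᴺ n m w = ∑[ i < n ] ∑[ j < m ] isHole (w i j)

tabulate-toℕ : ∀ {A : Set} n (f : ℕ → A) → tabulate {n = n} (f ∘ toℕ) ≡ applyUpTo f n
tabulate-toℕ zero    f = refl
tabulate-toℕ (suc n) f = cong (f 0 ∷_) (tabulate-toℕ n (f ∘ suc))

sum-allFin : ∀ n (f : ℕ → ℕ) → sum (map (f ∘ toℕ) (allFin n)) ≡ ∑< n f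
sum-allFin n f = cong sum (trans (map-tabulate {n = n} (λ i → i) (f ∘ toℕ)) (tabulate-toℕ n f))

holes-restrict : ∀ {k} n m (w : Word k) → holes (restrict n m w) ≡ holesᴺ n m w
holes-restrict n m w =
  trans (cong sum (map-cong (λ i → sum-allFin m (λ j → isHole (w (toℕ i) j))) (allFin n)))
        (sum-allFin n (λ i → ∑[ j < m ] isHole (w i j)))

holesᴺ-transpose : ∀ {k} n m (w : Word k) → holesᴺ m n (flip w) ≡ holesᴺ n m w
holesᴺ-transpose n m w = ∑-comm m n (λ j i → isHole (w i j))

holesᴺ≤HB2 : ∀ {k n m h} {w : Word k} → IsHB2 k (suc n) (suc m) h → UnborderedWord (suc n) (suc m) w →
  holesᴺ (suc n) (suc m) w ≤ h
holesᴺ≤HB2 {n = n} {m} {h} {w} (_ , maximal) unbordered =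
  subst (_≤ h) (holes-restrict (suc n) (suc m) w) (maximal (restrict (suc n) (suc m) w) (unbordered-restrict unbordered))

holes-covering : ∀ {k} n m (w : Word k) (c : ℕ → ℕ → ℕ) → (∀ i j → 1 ≤ isHole (w i j) + c i j) →
  n * m ≤ holesᴺ n m w + ∑[ i < n ] ∑[ j < m ] c i j
holes-covering n m w c covered = begin
  n * m                                            ≡⟨ ∑∑-const ⟨
  ∑[ i < n ] ∑[ j < m ] 1                          ≤⟨ ∑-mono n (λ i → ∑-mono m (covered i)) ⟩
  ∑[ i < n ] ∑[ j < m ] (isHole (w i j) + c i j)   ≡⟨ ∑∑-+ n m _ c ⟩
  holesᴺ n m w + ∑[ i < n ] ∑[ j < m ] c i j       ∎
  where
  open ≤-Reasoning
  ∑∑-const : ∑[ i < n ] ∑[ j < m ] 1 ≡ n * m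
  ∑∑-const = trans (∑-cong n (λ _ → trans (∑-const m 1) (*-identityʳ m))) (∑-const n m)

-- The construction

module Construction (k n m s t : ℕ) where

  cell : (block blockCol stub lattice : Bool) → Maybe (Fin (2 + k))
  cell true  true  _     _     = just 1F
  cell true  false _     _     = nothing
  cell false _     true  _     = just 1F
  cell false _     false true  = just 0F
  cell false _     false false = nothing

  cell-covered : ∀ a b c d → 1 ≤ isHole (cell a b c d) + (𝟙 (a ∧ b) + 𝟙 c + 𝟙 d)
  cell-covered true  true  _     _     = s≤s z≤n
  cell-covered true  false _     _     = s≤s z≤n
  cell-covered false _     true  _     = s≤s z≤n
  cell-covered false _     false true  = s≤s z≤n
  cell-covered false _     false false = s≤s z≤n

  BlockCol LatticeRow LatticeCol : Pred ℕ 0ℓ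
  BlockCol   j = j < t ⊎ m ≤ j + t
  LatticeRow i = s ∣ i ⊎ i ≡ suc s ⊎ suc i ≡ n
  LatticeCol j = t ∣ j ⊎ suc j ≡ m

  blockCol? : Decidable BlockCol
  blockCol? = (_<? t) ∪? (λ j → m ≤? j + t)

  latticeRow? : Decidable LatticeRow
  latticeRow? = (s ∣?_) ∪? (_≟ suc s) ∪? (λ i → suc i ≟ n)

  latticeCol? : Decidable LatticeCol
  latticeCol? = (t ∣?_) ∪? (λ j → suc j ≟ m)

  word : Word (2 + k)
  word i j = cell (does (i <? s)) (does (blockCol? j)) (does ((i ≟ suc s) ×-dec (j <? t)))
                  (does (latticeRow? i ×-dec latticeCol? j))

  word-block : ∀ {i j} → i < s → BlockCol j → word i j ≡ just 1F
  word-block {i} {j} i<s col with does (i <? s) | dec-true (i <? s) i<s | does (blockCol? j) | dec-true (blockCol? j) col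
  ... | _ | refl | _ | refl = refl

  word-stub : ∀ {j} → j < t → word (suc s) j ≡ just 1F
  word-stub {j} j<t with does (suc s <? s) | dec-false (suc s <? s) (≤⇒≯ (n≤1+n s))
                       | does ((suc s ≟ suc s) ×-dec (j <? t)) | dec-true ((suc s ≟ suc s) ×-dec (j <? t)) (refl , j<t)
  ... | _ | refl | _ | refl = refl

  word-lattice : ∀ {i j} → s ≤ i → ¬ (i ≡ suc s × j < t) → LatticeRow i → LatticeCol j → word i j ≡ just 0F
  word-lattice {i} {j} s≤i ¬stub row col
    with does (i <? s) | dec-false (i <? s) (≤⇒≯ s≤i)
       | does ((i ≟ suc s) ×-dec (j <? t)) | dec-false ((i ≟ suc s) ×-dec (j <? t)) ¬stub
       | does (latticeRow? i ×-dec latticeCol? j) | dec-true (latticeRow? i ×-dec latticeCol? j) (row , col)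
  ... | _ | refl | _ | refl | _ | refl = refl

  cover : ℕ → ℕ → ℕ
  cover i j = 𝟙 (does (i <? s)) * 𝟙 (does (blockCol? j))
            + 𝟙 (does (i ≟ suc s)) * 𝟙 (does (j <? t))
            + 𝟙 (does (latticeRow? i)) * 𝟙 (does (latticeCol? j))

  word-covered : ∀ i j → 1 ≤ isHole (word i j) + cover i j
  word-covered i j = subst (λ c → 1 ≤ isHole (word i j) + c)
    (cong₂ _+_ (cong₂ _+_ (𝟙-∧ r₁ c₁) (𝟙-∧ r₂ c₂)) (𝟙-∧ r₃ c₃)) (cell-covered r₁ c₁ (r₂ ∧ c₂) (r₃ ∧ c₃))
    where
    r₁ = does (i <? s)
    c₁ = does (blockCol? j)
    r₂ = does (i ≟ suc s)
    c₂ = does (j <? t)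
    r₃ = does (latticeRow? i)
    c₃ = does (latticeCol? j)

  ∑-cover : ∑[ i < n ] ∑[ j < m ] cover i j ≡
    count (_<? s) n * count blockCol? m + count (_≟ suc s) n * count (_<? t) m
      + count latticeRow? n * count latticeCol? m
  ∑-cover = trans (∑∑-+ n m _ _) (cong₂ _+_ (trans (∑∑-+ n m _ _)
    (cong₂ _+_ (∑-product n m _ _) (∑-product n m _ _))) (∑-product n m _ _))

  module Properties (1<s : 1 < s) (2s²≤n : 2 * (s * s) ≤ n) (n<2[1+s]² : n < 2 * (suc s * suc s))
                    (0<t : 0 < t) (t²≤m : t * t ≤ m) (m<[1+t]² : m < suc t * suc t) where

    instance
      s≢0 : NonZero s
      s≢0 = >-nonZero (<-trans z<s 1<s)
      t≢0 : NonZero t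
      t≢0 = >-nonZero 0<t
      n≢0 : NonZero n
      n≢0 = >-nonZero (<-≤-trans (*-monoʳ-< 2 (*-mono-< (<-trans z<s 1<s) (<-trans z<s 1<s))) 2s²≤n)
      m≢0 : NonZero m
      m≢0 = >-nonZero (<-≤-trans (*-mono-< 0<t 0<t) t²≤m)

    3+s≤n : 3 + s ≤ n
    3+s≤n = ≤-trans (3+s≤2s² s 1<s) 2s²≤n
      where
      3+s≤2s² : ∀ s → 1 < s → 3 + s ≤ 2 * (s * s)
      3+s≤2s² (suc zero) (s≤s ())
      3+s≤2s² (suc (suc r)) _ = subst (3 + suc (suc r) ≤_) (identity r) (m≤m+n _ _)
        where
        identity : ∀ r → 3 + suc (suc r) + (2 * (r * r) + 7 * r + 3) ≡ 2 * (suc (suc r) * suc (suc r))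
        identity = solve-∀

    s∤1+s : ¬ s ∣ suc s
    s∤1+s s∣1+s = <⇒≢ 1<s (sym (∣1⇒≡1 (∣m+n∣m⇒∣n (subst (s ∣_) (+-comm 1 s) s∣1+s) ∣-refl)))

    ZeroRow : Pred ℕ 0ℓ
    ZeroRow i = s ≤ i × i ≢ suc s × LatticeRow i

    word-zero : ∀ {i j} → ZeroRow i → LatticeCol j → word i j ≡ just 0F
    word-zero (s≤i , i≢1+s , row) col = word-lattice s≤i (i≢1+s ∘ proj₁) row col

    zeroRow-in-window : ∀ x → 0 < x → x < n → ∃[ d ] d < s × d + x < n × ZeroRow (d + x)
    zeroRow-in-window x 0<x x<n with gridline-in-window s x x<n
    ... | d , d<s , ℓ<n , inj₁ s∣ℓ =
      d , d<s , ℓ<n , ∣⇒≤ {{>-nonZero (<-≤-trans 0<x (m≤n+m x d))}} s∣ℓ , (λ ℓ≡1+s → s∤1+s (subst (s ∣_) ℓ≡1+s s∣ℓ)) , inj₁ s∣ℓ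
    ... | d , d<s , ℓ<n , inj₂ 1+ℓ≡n =
      d , d<s , ℓ<n , ≤-trans (n≤1+n s) (<⇒≤ 1+s<ℓ) , (λ ℓ≡1+s → <⇒≢ 1+s<ℓ (sym ℓ≡1+s)) , inj₂ (inj₂ 1+ℓ≡n)
      where
      1+s<ℓ : suc s < d + x
      1+s<ℓ = ≤-pred (subst (3 + s ≤_) (sym 1+ℓ≡n) 3+s≤n)

    t≤latticeCol : ∀ {ℓ} → 0 < ℓ → LatticeCol ℓ → t ≤ ℓ
    t≤latticeCol 0<ℓ (inj₁ t∣ℓ) = ∣⇒≤ {{>-nonZero 0<ℓ}} t∣ℓ
    t≤latticeCol {ℓ} 0<ℓ (inj₂ 1+ℓ≡m) with t ≤? ℓ
    ... | yes t≤ℓ = t≤ℓ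
    ... | no  t≰ℓ = contradiction (m<m*n (suc ℓ) (suc ℓ) (s≤s 0<ℓ)) (≤⇒≯ (begin
      suc ℓ * suc ℓ ≤⟨ *-mono-≤ (≰⇒> t≰ℓ) (≰⇒> t≰ℓ) ⟩
      t * t         ≤⟨ t²≤m ⟩
      m             ≡⟨ 1+ℓ≡m ⟨
      suc ℓ         ∎))
      where open ≤-Reasoning

    descending : ∀ x y → 0 < x → x < n → y < m → ∃₂ λ i j → Mismatch n m word (i + x) (j + y) i j
    descending x y 0<x x<n y<m with zeroRow-in-window x 0<x x<n | gridline-in-window t y y<m
    ... | d , d<s , d+x<n , zero-row | d′ , d′<t , d′+y<m , col =
      d , d′ , d+x<n , d′+y<m , ≤-<-trans (m≤m+n d x) d+x<n , ≤-<-trans (m≤m+n d′ y) d′+y<m ,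
      0F , 1F , word-zero zero-row col , word-block d<s (inj₁ d′<t) , λ ()

    ascending : ∀ x y → 0 < x → x < n → 0 < y → y < m → ∃₂ λ i j → Mismatch n m word (i + x) j i (j + y)
    ascending x y 0<x x<n _ y<m with zeroRow-in-window x 0<x x<n | multiple-before-end t y y<m
    ... | d , d<s , d+x<n , zero-row | q , qt+y<m , m≤qt+y+t =
      d , q * t , d+x<n , ≤-<-trans (m≤m+n (q * t) y) qt+y<m , ≤-<-trans (m≤m+n d x) d+x<n , qt+y<m ,
      0F , 1F , word-zero zero-row (inj₁ (divides q refl)) , word-block d<s (inj₂ m≤qt+y+t) , λ ()

    horizontal : ∀ y → 0 < y → y < m → ∃₂ λ i j → Mismatch n m word i (j + y) i j
    horizontal y 0<y y<m with gridline-in-window t y y<m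
    ... | d , d<t , d+y<m , col =
      suc s , d , 1+s<n , d+y<m , 1+s<n , ≤-<-trans (m≤m+n d y) d+y<m ,
      0F , 1F , word-lattice (n≤1+n s) (λ (_ , d+y<t) → ≤⇒≯ t≤d+y d+y<t) (inj₂ (inj₁ refl)) col ,
      word-stub d<t , λ ()
      where
      1+s<n : suc s < n
      1+s<n = ≤-trans (s≤s (m≤n+m (suc s) 1)) 3+s≤n
      t≤d+y : t ≤ d + y
      t≤d+y = t≤latticeCol (<-≤-trans 0<y (m≤n+m y d)) col

    unbordered : UnborderedWord n m word
    unbordered = separating-from-quadrants descending ascending horizontal ,
                 1F , word-block (<-trans z<s 1<s) (inj₁ 0<t)

    count-latticeRow : count latticeRow? n ≤ 2 * s + 5 + (1 + 1)
    count-latticeRow = ≤-trans (count-∪ (s ∣?_) ((_≟ suc s) ∪? (λ i → suc i ≟ n)) n) (+-mono-≤ multiples (≤-trans (count-∪ (_≟ suc s) (λ i → suc i ≟ n) n)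
      (+-mono-≤ (count-unique (_≟ suc s) (λ i≡ j≡ → trans i≡ (sym j≡)) n)
                (count-unique (λ i → suc i ≟ n) (λ i≡ j≡ → suc-injective (trans i≡ (sym j≡))) n))))
      where
      identity : ∀ s → 2 * (suc s * suc s) + s ≡ suc (suc (s * (2 * s + 5)))
      identity = solve-∀
      multiples : count (s ∣?_) n ≤ 2 * s + 5
      multiples = *-cancelˡ-≤ s (≤-pred (≤-pred (begin
        suc (suc (s * count (s ∣?_) n)) ≤⟨ s≤s (count-∣ s n) ⟩
        suc n + s                        ≤⟨ +-monoˡ-≤ s n<2[1+s]² ⟩
        2 * (suc s * suc s) + s          ≡⟨ identity s ⟩
        suc (suc (s * (2 * s + 5)))      ∎)))
        where open ≤-Reasoning

    count-latticeCol : count latticeCol? m ≤ t + 2 + 1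
    count-latticeCol = ≤-trans (count-∪ (t ∣?_) (λ j → suc j ≟ m) m)
      (+-mono-≤ multiples (count-unique (λ j → suc j ≟ m) (λ i≡ j≡ → suc-injective (trans i≡ (sym j≡))) m))
      where
      identity : ∀ t → suc t * suc t + t ≡ suc (t * suc (t + 2))
      identity = solve-∀
      multiples : count (t ∣?_) m ≤ t + 2
      multiples = ≤-pred (*-cancelˡ-< t (count (t ∣?_) m) (suc (t + 2)) (≤-pred (begin
        suc (suc (t * count (t ∣?_) m)) ≤⟨ s≤s (count-∣ t m) ⟩
        suc m + t                        ≤⟨ +-monoˡ-≤ t m<[1+t]² ⟩
        suc t * suc t + t                ≡⟨ identity t ⟩
        suc (t * suc (t + 2))            ∎)))
        where open ≤-Reasoning

    ∑-cover≤ : ∑[ i < n ] ∑[ j < m ] cover i j ≤ s * (t + t) + 1 * t + (2 * s + 5 + (1 + 1)) * (t + 2 + 1)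
    ∑-cover≤ = ≤-trans (≤-reflexive ∑-cover) (+-mono-≤ (+-mono-≤
      (*-mono-≤ (count-< s n) (≤-trans (count-∪ (_<? t) (λ j → m ≤? j + t) m) (+-mono-≤ (count-< t m) (count-last t m))))
      (*-mono-≤ (count-unique (_≟ suc s) (λ i≡ j≡ → trans i≡ (sym j≡)) n) (count-< t m)))
      (*-mono-≤ count-latticeRow count-latticeCol))

    holes-bound : n * m ≤ holesᴺ n m word + 4 * (s * t) + 49 * s + 49 * t
    holes-bound = begin
      n * m                                       ≤⟨ holes-covering n m word cover word-covered ⟩
      holesᴺ n m word + ∑[ i < n ] ∑[ j < m ] cover i j ≤⟨ +-monoʳ-≤ (holesᴺ n m word) ∑-cover≤ ⟩
      holesᴺ n m word + (s * (t + t) + 1 * t + (2 * s + 5 + (1 + 1)) * (t + 2 + 1))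
        ≤⟨ arithmetic (holesᴺ n m word) s t (<-trans z<s 1<s) ⟩
      holesᴺ n m word + 4 * (s * t) + 49 * s + 49 * t ∎
      where
      open ≤-Reasoning
      arithmetic : ∀ H s t → 0 < s → H + (s * (t + t) + 1 * t + (2 * s + 5 + (1 + 1)) * (t + 2 + 1))
                                      ≤ H + 4 * (s * t) + 49 * s + 49 * t
      arithmetic H (suc r) t _ = subst (lhs ≤_) (identity H r t) (m≤m+n lhs (43 * r + 22 + 41 * t))
        where
        lhs = H + (suc r * (t + t) + 1 * t + (2 * suc r + 5 + (1 + 1)) * (t + 2 + 1))
        identity : ∀ H r t →
          H + (suc r * (t + t) + 1 * t + (2 * suc r + 5 + (1 + 1)) * (t + 2 + 1)) + (43 * r + 22 + 41 * t)
            ≡ H + 4 * (suc r * t) + 49 * suc r + 49 * t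
        identity = solve-∀

-- p, q and 4pq are integer lower approximations of √n, √m and √(8nm) = 2√2·√(nm).
record HoleBound (C n m h : ℕ) : Set where
  constructor holeBound
  field
    p q        : ℕ
    p²≤n       : p * p ≤ n
    q²≤m       : q * q ≤ m
    [4pq]²≤8nm : 4 * (p * q) * (4 * (p * q)) ≤ 8 * (n * m)
    nm≤        : n * m ≤ h + 4 * (p * q) + C * p + C * q

holeBound-mono : ∀ {C n m h h′} → h ≤ h′ → HoleBound C n m h → HoleBound C n m h′
holeBound-mono {C} h≤h′ (holeBound p q p²≤n q²≤m [4pq]²≤8nm nm≤) =
  holeBound p q p²≤n q²≤m [4pq]²≤8nm $
  ≤-trans nm≤ (+-monoˡ-≤ (C * q) (+-monoˡ-≤ (C * p) (+-monoˡ-≤ (4 * (p * q)) h≤h′)))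

holeBound-transpose : ∀ {C n m h} → HoleBound C n m h → HoleBound C m n h
holeBound-transpose {C} {n} {m} {h} (holeBound p q p²≤n q²≤m [4pq]²≤8nm nm≤) =
  holeBound q p q²≤m p²≤n (subst₂ (λ a b → 4 * a * (4 * a) ≤ 8 * b) (*-comm p q) (*-comm n m) [4pq]²≤8nm) $
  subst₂ _≤_ (*-comm n m) (swap h p q C) nm≤
  where
  swap : ∀ h p q C → h + 4 * (p * q) + C * p + C * q ≡ h + 4 * (q * p) + C * q + C * p
  swap = solve-∀

holeBound-small : ∀ {n m h} → n ≤ 7 → m ≤ 7 → 0 < m → HoleBound 49 n m h
holeBound-small {n} {m} {h} n≤7 m≤7 0<m =
  holeBound 0 1 z≤n 0<m z≤n $ ≤-trans (*-mono-≤ n≤7 m≤7) (m≤n+m 49 (h + 0 + 0))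

construction : ∀ k n m → 8 ≤ n → 0 < m →
  Σ (Word (2 + k)) λ w → UnborderedWord n m w × HoleBound 49 n m (holesᴺ n m w)
construction k n m 8≤n 0<m with scaled-sqrt 2 n | scaled-sqrt 1 m
... | s , 2s²≤n , n<2[1+s]² | t , t²≤m , m<[1+t]² =
  word , unbordered , holeBound s t (≤-trans (m≤m+n (s * s) (s * s + 0)) 2s²≤n) t²≤m′ [4st]²≤8nm holes-bound
  where
  1<s : 1 < s
  1<s = sqrt-large s n<2[1+s]²
    where
    sqrt-large : ∀ s → n < 2 * (suc s * suc s) → 1 < s
    sqrt-large zero          n<2 = contradiction (<-≤-trans n<2 (s≤s (s≤s z≤n))) (≤⇒≯ 8≤n)
    sqrt-large (suc zero)    n<8 = contradiction n<8 (≤⇒≯ 8≤n)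
    sqrt-large (suc (suc _)) _   = s≤s (s≤s z≤n)
  t²≤m′ : t * t ≤ m
  t²≤m′ = subst (_≤ m) (*-identityˡ (t * t)) t²≤m
  m<[1+t]²′ : m < suc t * suc t
  m<[1+t]²′ = subst (m <_) (*-identityˡ (suc t * suc t)) m<[1+t]²
  0<t : 0 < t
  0<t = sqrt-positive t m<[1+t]²′
    where
    sqrt-positive : ∀ t → m < suc t * suc t → 0 < t
    sqrt-positive zero    m<1 = contradiction m<1 (≤⇒≯ 0<m)
    sqrt-positive (suc _) _   = z<s
  [4st]²≤8nm : 4 * (s * t) * (4 * (s * t)) ≤ 8 * (n * m)
  [4st]²≤8nm = subst (_≤ 8 * (n * m)) (identity s t) (*-monoʳ-≤ 8 (*-mono-≤ 2s²≤n t²≤m′))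
    where
    identity : ∀ s t → 8 * (2 * (s * s) * (t * t)) ≡ 4 * (s * t) * (4 * (s * t))
    identity = solve-∀
  open Construction k n m s t
  open Properties 1<s 2s²≤n n<2[1+s]² 0<t t²≤m′ m<[1+t]²′

unbordered-transpose : ∀ {k n m} {w : Word k} → UnborderedWord n m w → UnborderedWord m n (flip w)
unbordered-transpose (separating , w00) = separating-transpose separating , w00

hb2-holeBound : ∀ k n m h → 2 ≤ k → 1 ≤ n → 1 ≤ m → IsHB2 k n m h → HoleBound 49 n m h
hb2-holeBound (suc (suc k)) (suc n) (suc m) h (s≤s (s≤s _)) (s≤s _) (s≤s _) hb with 8 ≤? suc n | 8 ≤? suc m
... | yes 8≤n | _ =
  let w , unbordered , bound = construction k (suc n) (suc m) 8≤n z<s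
  in  holeBound-mono (holesᴺ≤HB2 hb unbordered) bound
... | no _ | yes 8≤m =
  let w , unbordered , bound = construction k (suc m) (suc n) 8≤m z<s
      holes≤h = holesᴺ≤HB2 hb (unbordered-transpose unbordered)
  in  holeBound-transpose (holeBound-mono (subst (_≤ h) (holesᴺ-transpose (suc m) (suc n) w) holes≤h) bound)
... | no n≱8 | no m≱8 = holeBound-small (≤-pred (≰⇒> n≱8)) (≤-pred (≰⇒> m≱8)) z<s

-- Passing to ℚ

ι : ℕ → ℚ
ι x = + x / 1

toℚᵘ-ι : ∀ x → toℚᵘ (ι x) ≡ mkℚᵘ (+ x) 0
toℚᵘ-ι x = cong toℚᵘ (ℚₚ.normalize-coprime (coprime-sym (1-coprimeTo x)))

ι-+ : ∀ x y → ι (x + y) ≡ ι x ℚ.+ ι y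
ι-+ x y = ℚₚ.toℚᵘ-injective (begin
  toℚᵘ (ι (x + y))                ≡⟨ toℚᵘ-ι (x + y) ⟩
  mkℚᵘ (+ (x + y)) 0              ≈⟨ *≡* (trans (cong (ℤ._* + 1) (ℤₚ.pos-+ x y)) (identity (+ x) (+ y))) ⟩
  mkℚᵘ (+ x) 0 ℚᵘ.+ mkℚᵘ (+ y) 0  ≡⟨ cong₂ ℚᵘ._+_ (toℚᵘ-ι x) (toℚᵘ-ι y) ⟨
  toℚᵘ (ι x) ℚᵘ.+ toℚᵘ (ι y)      ≈⟨ ℚₚ.toℚᵘ-homo-+ (ι x) (ι y) ⟨
  toℚᵘ (ι x ℚ.+ ι y)              ∎)
  where
  open ℚᵘₚ.≃-Reasoning
  identity : ∀ a b → (a ℤ.+ b) ℤ.* + 1 ≡ (a ℤ.* + 1 ℤ.+ b ℤ.* + 1) ℤ.* + 1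
  identity = ℤ-solve-∀

ι-* : ∀ x y → ι (x * y) ≡ ι x ℚ.* ι y
ι-* x y = ℚₚ.toℚᵘ-injective (begin
  toℚᵘ (ι (x * y))                ≡⟨ toℚᵘ-ι (x * y) ⟩
  mkℚᵘ (+ (x * y)) 0              ≈⟨ *≡* (cong (ℤ._* + 1) (ℤₚ.pos-* x y)) ⟩
  mkℚᵘ (+ x) 0 ℚᵘ.* mkℚᵘ (+ y) 0  ≡⟨ cong₂ ℚᵘ._*_ (toℚᵘ-ι x) (toℚᵘ-ι y) ⟨
  toℚᵘ (ι x) ℚᵘ.* toℚᵘ (ι y)      ≈⟨ ℚₚ.toℚᵘ-homo-* (ι x) (ι y) ⟨
  toℚᵘ (ι x ℚ.* ι y)              ∎)
  where open ℚᵘₚ.≃-Reasoning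

ι-mono-≤ : ∀ {x y} → x ≤ y → ι x ℚ.≤ ι y
ι-mono-≤ {x} {y} x≤y = ℚₚ.toℚᵘ-cancel-≤
  (subst₂ ℚᵘ._≤_ (sym (toℚᵘ-ι x)) (sym (toℚᵘ-ι y)) (ℚᵘ.*≤* (ℤₚ.*-monoʳ-≤-nonNeg (+ 1) (ℤ.+≤+ x≤y))))

≤-of-squares : ∀ {p q} → 0ℚ ℚ.≤ q → p ℚ.* p ℚ.≤ q ℚ.* q → p ℚ.≤ q
≤-of-squares {p} {q} 0≤q p²≤q² with p ℚₚ.≤? q
... | yes p≤q = p≤q
... | no  p≰q = contradiction (ℚₚ.≤-<-trans p²≤q² q²<p²) (ℚₚ.<-irrefl refl)
  where
  q<p : q ℚ.< p
  q<p = ℚₚ.≰⇒> p≰q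
  instance
    q≥0 : ℚ.NonNegative q
    q≥0 = ℚ.nonNegative 0≤q
    p>0 : ℚ.Positive p
    p>0 = ℚ.positive (ℚₚ.≤-<-trans 0≤q q<p)
  q²<p² : q ℚ.* q ℚ.< p ℚ.* p
  q²<p² = ℚₚ.≤-<-trans (ℚₚ.*-monoˡ-≤-nonNeg q (ℚₚ.<⇒≤ q<p)) (ℚₚ.*-monoˡ-<-pos p q<p)

ι-≤-sqrt : ∀ {r x a} → 0ℚ ℚ.≤ a → r * r ≤ x → ι x ℚ.≤ a ℚ.* a → ι r ℚ.≤ a
ι-≤-sqrt {r} 0≤a r²≤x x≤a² =
  ≤-of-squares 0≤a (subst (ℚ._≤ _) (ι-* r r) (ℚₚ.≤-trans (ι-mono-≤ r²≤x) x≤a²))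

holeBound⇒ℚ : ∀ {C n m h} → HoleBound C n m h → ∀ (a b c : ℚ) →
  0ℚ ℚ.≤ a → 0ℚ ℚ.≤ b → 0ℚ ℚ.≤ c →
  ι (8 * (n * m)) ℚ.≤ a ℚ.* a → ι n ℚ.≤ b ℚ.* b → ι m ℚ.≤ c ℚ.* c →
  ι (n * m) ℚ.≤ ι h ℚ.+ a ℚ.+ ι C ℚ.* b ℚ.+ ι C ℚ.* c
holeBound⇒ℚ {C} {n} {m} {h} (holeBound p q p²≤n q²≤m [4pq]²≤8nm nm≤) a b c 0≤a 0≤b 0≤c 8nm≤a² n≤b² m≤c² = begin
  ι (n * m)                                          ≤⟨ ι-mono-≤ nm≤ ⟩
  ι (h + 4 * (p * q) + C * p + C * q)                ≡⟨ ι-hom ⟩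
  ι h ℚ.+ ι (4 * (p * q)) ℚ.+ ι C ℚ.* ι p ℚ.+ ι C ℚ.* ι q
    ≤⟨ ℚₚ.+-mono-≤ (ℚₚ.+-mono-≤ (ℚₚ.+-monoʳ-≤ (ι h) (ι-≤-sqrt {4 * (p * q)} 0≤a [4pq]²≤8nm 8nm≤a²))
                                (ℚₚ.*-monoˡ-≤-nonNeg (ι C) (ι-≤-sqrt {p} 0≤b p²≤n n≤b²)))
                   (ℚₚ.*-monoˡ-≤-nonNeg (ι C) (ι-≤-sqrt {q} 0≤c q²≤m m≤c²)) ⟩
  ι h ℚ.+ a ℚ.+ ι C ℚ.* b ℚ.+ ι C ℚ.* c               ∎
  where
  open ℚₚ.≤-Reasoning
  instance
    C≥0 : ℚ.NonNegative (ι C)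
    C≥0 = ℚ.nonNegative (ι-mono-≤ {0} {C} z≤n)
  ι-hom : ι (h + 4 * (p * q) + C * p + C * q) ≡ ι h ℚ.+ ι (4 * (p * q)) ℚ.+ ι C ℚ.* ι p ℚ.+ ι C ℚ.* ι q
  ι-hom = trans (ι-+ (h + 4 * (p * q) + C * p) (C * q))
    (cong₂ ℚ._+_ (trans (ι-+ (h + 4 * (p * q)) (C * p)) (cong₂ ℚ._+_ (ι-+ h (4 * (p * q))) (ι-* C p))) (ι-* C q))

theorem11 : Σ ℕ λ C → (0 < C) ×
    (∀ (k n m : ℕ) → 2 ≤ k → 1 ≤ n → 1 ≤ m → ∀ (h : ℕ) → IsHB2 k n m h →
      ∀ (a b c : ℚ) → ℚ.0ℚ ℚ.≤ a → ℚ.0ℚ ℚ.≤ b → ℚ.0ℚ ℚ.≤ c →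
        (+ (8 * (n * m))) / 1 ℚ.≤ a ℚ.* a →
        (+ n) / 1 ℚ.≤ b ℚ.* b →
        (+ m) / 1 ℚ.≤ c ℚ.* c →
        (+ (n * m)) / 1 ℚ.≤ (+ h) / 1 ℚ.+ a ℚ.+ ((+ C) / 1) ℚ.* b ℚ.+ ((+ C) / 1) ℚ.* c)
theorem11 = 49 , s≤s z≤n , λ k n m 2≤k 1≤n 1≤m h hb → holeBound⇒ℚ (hb2-holeBound k n m h 2≤k 1≤n 1≤m hb)
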